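{- Let $p$ be a prime and $m>2$ an integer, and let $n=p^m$. Then the adjacency spectrum of the essential ideal graph $\mathcal{E}_{\mathbb{Z}_n}$ consists of the eigenvalue $m-2$ with multiplicity $1$ and the eigenvalue $-1$ with multiplicity $m-2$.
   Context: $\mathbb{Z}_n$ is the ring of integers modulo $n$. An ideal $I$ of a commutative ring $R$ is essential if $I\cap J\neq\{0\}$ for every nonzero ideal $J$ of $R$. The essential ideal graph $\mathcal{E}_{\mathbb{Z}_n}$ is the simple graph whose vertex set is the set of all nonzero proper ideals of $\mathbb{Z}_n$, two distinct vertices $I,K$ being adjacent if and only if $I+K$ is an essential ideal of $\mathbb{Z}_n$. The (adjacency) spectrum of a graph is the multiset of eigenvalues of its adjacency matrix. -}

module Defs where

open import Level using (0ℓ)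
open import Data.Nat as ℕ using (ℕ; zero; suc; NonZero)
open import Data.Nat.Properties using (m^n≢0)
open import Data.Nat.DivMod using (_%_; m%n<n)
open import Data.Nat.Primality using (Prime; prime⇒nonZero)
open import Data.Fin as Fin using (Fin; toℕ; fromℕ<; punchIn)
open import Data.Fin.Subset using (Subset; _∈_; _∉_)
open import Data.Integer as ℤ using (ℤ; +_; -_)
open import Data.List using (List; length; lookup)
import Data.List.Membership.Propositional as LM
open import Data.List.Relation.Unary.Unique.Propositional using (Unique)
open import Data.Product using (Σ; ∃; ∃-syntax; _×_; _,_)
open import Data.Sum using (_⊎_)
open import Relation.Nullary using (¬_)
open import Relation.Binary.PropositionalEquality using (_≡_; _≢_)
open import Function.Bundles using (_⇔_)

Matrix : ℕ → Set
Matrix k = Fin k → Fin k → ℤ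

sumFin : ∀ k → (Fin k → ℤ) → ℤ
sumFin zero    f = + 0
sumFin (suc k) f = f Fin.zero ℤ.+ sumFin k (λ i → f (Fin.suc i))

sign : ℕ → ℤ
sign zero          = + 1
sign (suc zero)    = - (+ 1)
sign (suc (suc k)) = sign k

minor : ∀ {k} → Fin (suc k) → Matrix (suc k) → Matrix k
minor j M r c = M (Fin.suc r) (punchIn j c)

det : ∀ k → Matrix k → ℤ
det zero    M = + 1
det (suc k) M = sumFin (suc k) (λ j → sign (toℕ j) ℤ.* (M Fin.zero j ℤ.* det k (minor j M)))

-- identity-shifted matrix  λ·I − A  (evaluating the characteristic polynomial at λ)
charMat : ∀ {k} → ℤ → Matrix k → Matrix k
charMat {k} x A i j with i Fin.≟ j
... | Relation.Nullary.yes _ = x ℤ.- A i j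
... | Relation.Nullary.no  _ = ℤ.- A i j

module Zn (n : ℕ) .{{nz : NonZero n}} where

  toZn : ℕ → Fin n
  toZn a = fromℕ< (m%n<n a n)

  0ₙ : Fin n
  0ₙ = toZn 0

  _+ₙ_ : Fin n → Fin n → Fin n
  a +ₙ b = toZn (toℕ a ℕ.+ toℕ b)

  _*ₙ_ : Fin n → Fin n → Fin n
  a *ₙ b = toZn (toℕ a ℕ.* toℕ b)

  -ₙ_ : Fin n → Fin n
  -ₙ a = toZn (n ℕ.∸ toℕ a)

  record IsIdeal (S : Subset n) : Set where
    field
      zero∈ : 0ₙ ∈ S
      +-closed : ∀ a b → a ∈ S → b ∈ S → (a +ₙ b) ∈ S
      neg-closed : ∀ a → a ∈ S → (-ₙ a) ∈ S
      mul-closed : ∀ r a → a ∈ S → (r *ₙ a) ∈ S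

  NonzeroSet : Subset n → Set
  NonzeroSet S = ∃[ x ] (x ∈ S × x ≢ 0ₙ)

  ProperSet : Subset n → Set
  ProperSet S = ∃[ x ] (x ∉ S)

  IsNonzeroProperIdeal : Subset n → Set
  IsNonzeroProperIdeal S = IsIdeal S × NonzeroSet S × ProperSet S

  _∈Sum_,_ : Fin n → Subset n → Subset n → Set
  x ∈Sum I , K = ∃[ a ] ∃[ b ] (a ∈ I × b ∈ K × (a +ₙ b) ≡ x)

  SumEssential : Subset n → Subset n → Set
  SumEssential I K =
    ∀ (J : Subset n) → IsIdeal J → NonzeroSet J →
      ∃[ x ] (x ≢ 0ₙ × (x ∈Sum I , K) × x ∈ J)

  IsVertexList : List (Subset n) → Set
  IsVertexList L = Unique L × (∀ S → (S LM.∈ L) ⇔ IsNonzeroProperIdeal S)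

  Adjacent : (L : List (Subset n)) → Fin (length L) → Fin (length L) → Set
  Adjacent L i j = i ≢ j × SumEssential (lookup L i) (lookup L j)

  IsAdjacencyMatrix : (L : List (Subset n)) → Matrix (length L) → Set
  IsAdjacencyMatrix L A =
    ∀ i j → (A i j ≡ + 1 × Adjacent L i j) ⊎ (A i j ≡ + 0 × ¬ Adjacent L i j)

primePowNonZero : ∀ {p} → Prime p → ∀ m → NonZero (p ℕ.^ m)
primePowNonZero {p} pr m = m^n≢0 p m {{prime⇒nonZero pr}}

module Submission where

-- The ideals of ℤ_{p^m} form the chain (p^k), 0 ≤ k ≤ m: a nonzero ideal is
-- generated by its least positive element, a divisor of p^m.  Hence every
-- nonzero ideal contains p^{m-1}, so I + K is essential as soon as I ≠ 0, and
-- the essential ideal graph is the complete graph on the m - 1 ideals (p^k),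
-- 0 < k < m.  The adjacency matrix of the complete graph on K + 1 vertices is
-- J - I, whose characteristic polynomial is (x - K)(x + 1)^K.

open import Data.Nat using (ℕ; _<_; _∸_)
open import Data.Nat.Primality using (Prime)
open import Data.List using (List; lookup)
open import Data.List.Relation.Unary.All using (All)
open import Data.List.Relation.Unary.AllPairs using (AllPairs)
open import Data.List.Relation.Unary.Unique.Propositional using (Unique)
open import Data.Fin as Fin using (Fin)
open import Data.Empty using (⊥-elim)
open import Relation.Binary.PropositionalEquality using (_≡_; refl; sym; trans; cong)

lookup-All : ∀ {A : Set} {P : A → Set} {xs : List A} → All P xs → ∀ i → P (lookup xs i)
lookup-All (px All.∷ _)   Fin.zero    = px
lookup-All (_  All.∷ pxs) (Fin.suc i) = lookup-All pxs i

lookup-injective : ∀ {A : Set} {xs : List A} → Unique xs → ∀ i j → lookup xs i ≡ lookup xs j → i ≡ j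
lookup-injective (_  AllPairs.∷ _) Fin.zero    Fin.zero    _  = refl
lookup-injective (x≢ AllPairs.∷ _) Fin.zero    (Fin.suc j) eq = ⊥-elim (lookup-All x≢ j eq)
lookup-injective (x≢ AllPairs.∷ _) (Fin.suc i) Fin.zero    eq = ⊥-elim (lookup-All x≢ i (sym eq))
lookup-injective (_  AllPairs.∷ u) (Fin.suc i) (Fin.suc j) eq = cong Fin.suc (lookup-injective u i j eq)

module Determinant where

  open import Data.Nat as ℕ using (ℕ; zero; suc; pred; _<_; _≤_; z≤n; s≤s; _≟_; _<?_)
  import Data.Nat.Properties as ℕₚ
  open import Data.Integer using (ℤ; +_; -_; -1ℤ; _+_; _*_; _-_; _^_)
  import Data.Integer.Properties as ℤₚ
  open import Data.Integer.Tactic.RingSolver using (solve-∀)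
  open import Data.Fin as Fin using (Fin; toℕ; punchIn)
  import Data.Fin.Properties as FinP
  open import Data.Empty using (⊥-elim)
  open import Relation.Nullary using (yes; no)
  open import Relation.Binary.Definitions using (tri<; tri≈; tri>)
  open import Relation.Binary.PropositionalEquality
  open import Function using (_∘_)
  open import Defs using (Matrix; sumFin; sign; minor; det; charMat)

  -- Indexing by ℕ instead of Fin turns punchIn into a total function on
  -- ℕ; all statements only constrain the entries of the leading k × k block.
  MatrixN : Set
  MatrixN = ℕ → ℕ → ℤ

  sumN : ℕ → (ℕ → ℤ) → ℤ
  sumN zero    f = + 0
  sumN (suc k) f = f 0 + sumN k (λ i → f (suc i))

  punchInN : ℕ → ℕ → ℕ
  punchInN zero    c       = suc c
  punchInN (suc j) zero    = zero
  punchInN (suc j) (suc c) = suc (punchInN j c)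

  minorN : ℕ → MatrixN → MatrixN
  minorN j M r c = M (suc r) (punchInN j c)

  detN : ℕ → MatrixN → ℤ
  laplaceTerm : ℕ → MatrixN → ℕ → ℤ

  detN zero    M = + 1
  detN (suc k) M = sumN (suc k) (laplaceTerm k M)

  laplaceTerm k M j = sign j * (M 0 j * detN k (minorN j M))

  toℕ-punchIn : ∀ {k} (j : Fin (suc k)) (c : Fin k) → toℕ (punchIn j c) ≡ punchInN (toℕ j) (toℕ c)
  toℕ-punchIn Fin.zero    c           = refl
  toℕ-punchIn (Fin.suc j) Fin.zero    = refl
  toℕ-punchIn (Fin.suc j) (Fin.suc c) = cong suc (toℕ-punchIn j c)

  sumFin≡sumN : ∀ k (f : Fin k → ℤ) (g : ℕ → ℤ) → (∀ j → f j ≡ g (toℕ j)) → sumFin k f ≡ sumN k g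
  sumFin≡sumN zero    f g f≗g = refl
  sumFin≡sumN (suc k) f g f≗g = cong₂ _+_ (f≗g Fin.zero) (sumFin≡sumN k _ _ (λ j → f≗g (Fin.suc j)))

  det≡detN : ∀ k (M : Matrix k) (F : MatrixN) → (∀ i j → M i j ≡ F (toℕ i) (toℕ j)) → det k M ≡ detN k F
  det≡detN zero    M F M≗F = refl
  det≡detN (suc k) M F M≗F =
    sumFin≡sumN (suc k) _ (laplaceTerm k F) λ j →
    cong₂ (λ a d → sign (toℕ j) * (a * d)) (M≗F Fin.zero j)
      (det≡detN k (minor j M) (minorN (toℕ j) F) λ r c →
        trans (M≗F (Fin.suc r) (punchIn j c)) (cong (F (suc (toℕ r))) (toℕ-punchIn j c)))

  sumN-cong : ∀ k {f g : ℕ → ℤ} → (∀ j → j < k → f j ≡ g j) → sumN k f ≡ sumN k g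
  sumN-cong zero    f≗g = refl
  sumN-cong (suc k) f≗g = cong₂ _+_ (f≗g 0 (s≤s z≤n)) (sumN-cong k (λ j j<k → f≗g (suc j) (s≤s j<k)))

  punchInN-< : ∀ {k} j c → j < suc k → c < k → punchInN j c < suc k
  punchInN-< zero    c       j<        c<        = s≤s c<
  punchInN-< (suc j) zero    j<        (s≤s c<) = s≤s z≤n
  punchInN-< (suc j) (suc c) (s≤s j<) (s≤s c<) = s≤s (punchInN-< j c j< c<)

  detN-cong : ∀ k {M M' : MatrixN} → (∀ r c → r < k → c < k → M r c ≡ M' r c) → detN k M ≡ detN k M'
  detN-cong zero    M≗M' = refl
  detN-cong (suc k) M≗M' = sumN-cong (suc k) λ j j< →
    cong₂ (λ a d → sign j * (a * d)) (M≗M' 0 j (s≤s z≤n) j<)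
      (detN-cong k λ r c r< c< → M≗M' (suc r) (punchInN j c) (s≤s r<) (punchInN-< j c j< c<))

  EqualOutsideColumn : ℕ → ℕ → MatrixN → MatrixN → Set
  EqualOutsideColumn k j M M' = ∀ r c → r < k → c < k → c ≢ j → M r c ≡ M' r c

  punchOutN : ℕ → ℕ → ℕ
  punchOutN zero     zero    = zero
  punchOutN zero     (suc j) = j
  punchOutN (suc i)  zero    = zero
  punchOutN (suc i)  (suc j) = suc (punchOutN i j)

  punchInN-punchOutN : ∀ i j → j ≢ i → punchInN i (punchOutN i j) ≡ j
  punchInN-punchOutN zero    zero    j≢i = ⊥-elim (j≢i refl)
  punchInN-punchOutN zero    (suc j) j≢i = refl
  punchInN-punchOutN (suc i) zero    j≢i = refl
  punchInN-punchOutN (suc i) (suc j) j≢i = cong suc (punchInN-punchOutN i j (j≢i ∘ cong suc))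

  punchInN-injective : ∀ j c c' → punchInN j c ≡ punchInN j c' → c ≡ c'
  punchInN-injective zero    c       c'       eq = ℕₚ.suc-injective eq
  punchInN-injective (suc j) zero    zero     eq = refl
  punchInN-injective (suc j) (suc c) (suc c') eq = cong suc (punchInN-injective j c c' (ℕₚ.suc-injective eq))

  punchInᵢ≢i : ∀ j c → punchInN j c ≢ j
  punchInᵢ≢i (suc j) (suc c) eq = punchInᵢ≢i j c (ℕₚ.suc-injective eq)

  punchOutN-< : ∀ {k} i j → i < suc k → j < suc k → j ≢ i → punchOutN i j < k
  punchOutN-<         zero    zero    _        _        j≢i = ⊥-elim (j≢i refl)
  punchOutN-<         zero    (suc j) _        (s≤s j<) _   = j<
  punchOutN-< {zero}  (suc i) _       (s≤s ()) _        _
  punchOutN-< {suc k} (suc i) zero    _        _        _   = s≤s z≤n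
  punchOutN-< {suc k} (suc i) (suc j) (s≤s i<) (s≤s j<) j≢i = s≤s (punchOutN-< i j i< j< (j≢i ∘ cong suc))

  sumN-linear : ∀ k (f g : ℕ → ℤ) (s t : ℤ) → sumN k (λ j → s * f j + t * g j) ≡ s * sumN k f + t * sumN k g
  sumN-linear zero    f g s t = zeros s t
    where
    zeros : ∀ s t → + 0 ≡ s * + 0 + t * + 0
    zeros = solve-∀
  sumN-linear (suc k) f g s t =
    trans (cong (_+_ (s * f 0 + t * g 0)) (sumN-linear k (f ∘ suc) (g ∘ suc) s t))
          (regroup (f 0) (g 0) (sumN k (f ∘ suc)) (sumN k (g ∘ suc)) s t)
    where
    regroup : ∀ a b c d s t → s * a + t * b + (s * c + t * d) ≡ s * (a + c) + t * (b + d)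
    regroup = solve-∀

  detN-linear : ∀ k j (M M₁ M₂ : MatrixN) (s t : ℤ) → j < k →
    EqualOutsideColumn k j M M₁ → EqualOutsideColumn k j M M₂ →
    (∀ r → r < k → M r j ≡ s * M₁ r j + t * M₂ r j) →
    detN k M ≡ s * detN k M₁ + t * detN k M₂
  detN-linear (suc k) j M M₁ M₂ s t j< M≈M₁ M≈M₂ Mⱼ =
    trans (sumN-cong (suc k) term) (sumN-linear (suc k) (laplaceTerm k M₁) (laplaceTerm k M₂) s t)
    where
    term : ∀ i → i < suc k → laplaceTerm k M i ≡ s * laplaceTerm k M₁ i + t * laplaceTerm k M₂ i
    term i i< with i ≟ j
    ... | yes refl =
      trans (cong (λ a → sign j * (a * detN k (minorN j M))) (Mⱼ 0 (s≤s z≤n)))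
        (trans (distrib (sign j) (M₁ 0 j) (M₂ 0 j) (detN k (minorN j M)) s t)
          (cong₂ (λ d₁ d₂ → s * (sign j * (M₁ 0 j * d₁)) + t * (sign j * (M₂ 0 j * d₂)))
            (detN-cong k λ r c r< c< → M≈M₁ (suc r) (punchInN j c) (s≤s r<) (punchInN-< j c i< c<) (punchInᵢ≢i j c))
            (detN-cong k λ r c r< c< → M≈M₂ (suc r) (punchInN j c) (s≤s r<) (punchInN-< j c i< c<) (punchInᵢ≢i j c))))
      where
      distrib : ∀ g a b d s t → g * ((s * a + t * b) * d) ≡ s * (g * (a * d)) + t * (g * (b * d))
      distrib = solve-∀
    ... | no i≢j =
      trans (cong (λ d → sign i * (M 0 i * d)) minor-linear)
        (trans (distrib (sign i) (M 0 i) (detN k (minorN i M₁)) (detN k (minorN i M₂)) s t)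
          (cong₂ (λ a₁ a₂ → s * (sign i * (a₁ * detN k (minorN i M₁))) + t * (sign i * (a₂ * detN k (minorN i M₂))))
            (M≈M₁ 0 i (s≤s z≤n) i< i≢j) (M≈M₂ 0 i (s≤s z≤n) i< i≢j)))
      where
      j' : ℕ
      j' = punchOutN i j
      j≢i : j ≢ i
      j≢i = i≢j ∘ sym
      punchIn-j' : punchInN i j' ≡ j
      punchIn-j' = punchInN-punchOutN i j j≢i
      avoids-j : ∀ c → c ≢ j' → punchInN i c ≢ j
      avoids-j c c≢j' eq = c≢j' (punchInN-injective i c j' (trans eq (sym punchIn-j')))
      minor-linear : detN k (minorN i M) ≡ s * detN k (minorN i M₁) + t * detN k (minorN i M₂)
      minor-linear = detN-linear k j' (minorN i M) (minorN i M₁) (minorN i M₂) s t (punchOutN-< i j i< j< j≢i)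
        (λ r c r< c< c≢j' → M≈M₁ (suc r) (punchInN i c) (s≤s r<) (punchInN-< i c i< c<) (avoids-j c c≢j'))
        (λ r c r< c< c≢j' → M≈M₂ (suc r) (punchInN i c) (s≤s r<) (punchInN-< i c i< c<) (avoids-j c c≢j'))
        (λ r r< → subst (λ c → M (suc r) c ≡ s * M₁ (suc r) c + t * M₂ (suc r) c) (sym punchIn-j') (Mⱼ (suc r) (s≤s r<)))
      distrib : ∀ g a d₁ d₂ s t → g * (a * (s * d₁ + t * d₂)) ≡ s * (g * (a * d₁)) + t * (g * (a * d₂))
      distrib = solve-∀

  swapN : ℕ → ℕ → ℕ
  swapN zero    zero          = 1
  swapN zero    (suc zero)    = 0
  swapN zero    (suc (suc x)) = suc (suc x)
  swapN (suc c) zero          = zero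
  swapN (suc c) (suc x)       = suc (swapN c x)

  swapN-involutive : ∀ c x → swapN c (swapN c x) ≡ x
  swapN-involutive zero    zero          = refl
  swapN-involutive zero    (suc zero)    = refl
  swapN-involutive zero    (suc (suc x)) = refl
  swapN-involutive (suc c) zero          = refl
  swapN-involutive (suc c) (suc x)       = cong suc (swapN-involutive c x)

  swapN-left : ∀ c → swapN c c ≡ suc c
  swapN-left zero    = refl
  swapN-left (suc c) = cong suc (swapN-left c)

  swapN-right : ∀ c → swapN c (suc c) ≡ c
  swapN-right zero    = refl
  swapN-right (suc c) = cong suc (swapN-right c)

  swapN-other : ∀ c x → x ≢ c → x ≢ suc c → swapN c x ≡ x
  swapN-other zero    zero          x≢c x≢1+c = ⊥-elim (x≢c refl)
  swapN-other zero    (suc zero)    x≢c x≢1+c = ⊥-elim (x≢1+c refl)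
  swapN-other zero    (suc (suc x)) x≢c x≢1+c = refl
  swapN-other (suc c) zero          x≢c x≢1+c = refl
  swapN-other (suc c) (suc x)       x≢c x≢1+c = cong suc (swapN-other c x (x≢c ∘ cong suc) (x≢1+c ∘ cong suc))

  swapN-punchInN-suc : ∀ c x → swapN c (punchInN (suc c) x) ≡ punchInN c x
  swapN-punchInN-suc zero    zero    = refl
  swapN-punchInN-suc zero    (suc x) = refl
  swapN-punchInN-suc (suc c) zero    = refl
  swapN-punchInN-suc (suc c) (suc x) = cong suc (swapN-punchInN-suc c x)

  swapN-punchInN-above : ∀ c j x → suc c < j → swapN c (punchInN j x) ≡ punchInN j (swapN c x)
  swapN-punchInN-above zero    (suc zero)    x             (s≤s ())
  swapN-punchInN-above zero    (suc (suc j)) zero          _         = refl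
  swapN-punchInN-above zero    (suc (suc j)) (suc zero)    _         = refl
  swapN-punchInN-above zero    (suc (suc j)) (suc (suc x)) _         = refl
  swapN-punchInN-above (suc c) (suc j)       zero          _         = refl
  swapN-punchInN-above (suc c) (suc j)       (suc x)       (s≤s c<j) = cong suc (swapN-punchInN-above c j x c<j)

  swapN-punchInN-below : ∀ c j x → j < c → swapN c (punchInN j x) ≡ punchInN j (swapN (pred c) x)
  swapN-punchInN-below (suc c)       zero    x       _         = refl
  swapN-punchInN-below (suc zero)    (suc j) x       (s≤s ())
  swapN-punchInN-below (suc (suc c)) (suc j) zero    _         = refl
  swapN-punchInN-below (suc (suc c)) (suc j) (suc x) (s≤s j<c) = cong suc (swapN-punchInN-below (suc c) j x j<c)

  sign-suc : ∀ c → sign (suc c) ≡ - sign c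
  sign-suc zero          = refl
  sign-suc (suc zero)    = refl
  sign-suc (suc (suc c)) = sign-suc c

  sumN-swapN : ∀ c k f → suc c < k → sumN k (f ∘ swapN c) ≡ sumN k f
  sumN-swapN zero    (suc (suc k)) f _         = exchange (f 0) (f 1) (sumN k (f ∘ suc ∘ suc))
    where
    exchange : ∀ a b c → b + (a + c) ≡ a + (b + c)
    exchange = solve-∀
  sumN-swapN zero    (suc zero)    f (s≤s ())
  sumN-swapN (suc c) (suc k)       f (s≤s c<k) = cong (_+_ (f 0)) (sumN-swapN c k (f ∘ suc) c<k)

  sumN-neg : ∀ k f → sumN k (λ j → - f j) ≡ - sumN k f
  sumN-neg zero    f = refl
  sumN-neg (suc k) f = trans (cong (_+_ (- f 0)) (sumN-neg k (f ∘ suc))) (sym (ℤₚ.neg-distrib-+ (f 0) _))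

  swapColumns : ℕ → MatrixN → MatrixN
  swapColumns c M r x = M r (swapN c x)

  detN-swapColumns : ∀ k c M → suc c < k → detN k (swapColumns c M) ≡ - detN k M
  detN-swapColumns (suc k) c M c+1<k = begin
    detN (suc k) (swapColumns c M)                            ≡⟨ sym (sumN-swapN c (suc k) (laplaceTerm k (swapColumns c M)) c+1<k) ⟩
    sumN (suc k) (laplaceTerm k (swapColumns c M) ∘ swapN c)  ≡⟨ sumN-cong (suc k) term ⟩
    sumN (suc k) (λ j → - laplaceTerm k M j)                  ≡⟨ sumN-neg (suc k) (laplaceTerm k M) ⟩
    - detN (suc k) M                                          ∎
    where
    open ≡-Reasoning
    swappedMinor : ∀ j → j < suc k →
      sign (swapN c j) * detN k (minorN (swapN c j) (swapColumns c M)) ≡ - (sign j * detN k (minorN j M))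
    swappedMinor j j< with ℕₚ.<-cmp j c
    swappedMinor j j< | tri< j<c _ _ rewrite swapN-other c j (ℕₚ.<⇒≢ j<c) (ℕₚ.<⇒≢ (ℕₚ.m<n⇒m<1+n j<c)) =
      let instance _ = ℕ.>-nonZero (ℕₚ.≤-<-trans z≤n j<c)
          pred[c]+1<k = ℕₚ.≤-<-trans (ℕₚ.m≤pred[n]⇒suc[m]≤n ℕₚ.≤-refl) (ℕₚ.<-pred c+1<k) in
      trans (cong (sign j *_)
              (trans (detN-cong k λ r x _ _ → cong (M (suc r)) (swapN-punchInN-below c j x j<c))
                     (detN-swapColumns k (pred c) (minorN j M) pred[c]+1<k)))
            (sym (ℤₚ.neg-distribʳ-* (sign j) _))
    swappedMinor j j< | tri≈ _ refl _ rewrite swapN-left j | sign-suc j =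
      trans (cong (- sign j *_) (detN-cong k λ r x _ _ → cong (M (suc r)) (swapN-punchInN-suc j x)))
            (sym (ℤₚ.neg-distribˡ-* (sign j) _))
    swappedMinor j j< | tri> _ _ c<j with j ≟ suc c
    ... | yes refl rewrite swapN-right c =
      trans (cong₂ _*_ (trans (sym (ℤₚ.neg-involutive (sign c))) (cong -_ (sym (sign-suc c))))
              (detN-cong k λ r x _ _ → cong (M (suc r))
                (trans (cong (swapN c) (sym (swapN-punchInN-suc c x))) (swapN-involutive c _))))
            (sym (ℤₚ.neg-distribˡ-* (sign (suc c)) _))
    ... | no j≢1+c rewrite swapN-other c j (ℕₚ.>⇒≢ c<j) j≢1+c =
      let c+1<j = ℕₚ.≤∧≢⇒< c<j (j≢1+c ∘ sym) in
      trans (cong (sign j *_)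
              (trans (detN-cong k λ r x _ _ → cong (M (suc r)) (swapN-punchInN-above c j x c+1<j))
                     (detN-swapColumns k c (minorN j M) (ℕₚ.<-≤-trans c+1<j (ℕₚ.≤-pred j<)))))
            (sym (ℤₚ.neg-distribʳ-* (sign j) _))
    term : ∀ j → j < suc k → laplaceTerm k (swapColumns c M) (swapN c j) ≡ - laplaceTerm k M j
    term j j< rewrite swapN-involutive c j =
      trans (exchange (sign (swapN c j)) (M 0 j) _)
        (trans (cong (M 0 j *_) (swappedMinor j j<)) (pull-neg (M 0 j) (sign j) _))
      where
      exchange : ∀ g a d → g * (a * d) ≡ a * (g * d)
      exchange = solve-∀
      pull-neg : ∀ a g d → a * - (g * d) ≡ - (g * (a * d))
      pull-neg = solve-∀

  i≡-i⇒i≡0 : ∀ (i : ℤ) → i ≡ - i → i ≡ + 0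
  i≡-i⇒i≡0 (+ zero) _ = refl

  detN-equalAdjacentColumns : ∀ k c M → suc c < k → (∀ r → r < k → M r c ≡ M r (suc c)) → detN k M ≡ + 0
  detN-equalAdjacentColumns k c M c+1<k Mc≡Mc+1 =
    i≡-i⇒i≡0 _ (trans (detN-cong k swap-invariant) (detN-swapColumns k c M c+1<k))
    where
    swap-invariant : ∀ r x → r < k → x < k → M r x ≡ swapColumns c M r x
    swap-invariant r x r< _ with x ≟ c | x ≟ suc c
    ... | yes refl | _        = trans (Mc≡Mc+1 r r<) (cong (M r) (sym (swapN-left x)))
    ... | no _     | yes refl = trans (sym (Mc≡Mc+1 r r<)) (cong (M r) (sym (swapN-right c)))
    ... | no x≢c   | no x≢c+1 = cong (M r) (sym (swapN-other c x x≢c x≢c+1))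

  -- The equal column is moved next to column 0 by adjacent swaps.
  detN-equalColumns : ∀ d k M → suc d < k → (∀ r → r < k → M r 0 ≡ M r (suc d)) → detN k M ≡ + 0
  detN-equalColumns zero    k M d+1<k M0≡Md+1 = detN-equalAdjacentColumns k 0 M d+1<k M0≡Md+1
  detN-equalColumns (suc d) k M d+2<k M0≡Md+2 =
    ℤₚ.neg-injective (trans (sym (detN-swapColumns k (suc d) M d+2<k))
      (detN-equalColumns d k (swapColumns (suc d) M) (ℕₚ.<-trans (ℕₚ.n<1+n _) d+2<k)
        (λ r r< → trans (M0≡Md+2 r r<) (cong (M r) (sym (swapN-left (suc d)))))))

  replaceColumn : ℕ → (ℕ → ℤ) → MatrixN → MatrixN
  replaceColumn j v M r c with c ≟ j
  ... | yes _ = v r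
  ... | no  _ = M r c

  replaceColumn-same : ∀ j v M r → replaceColumn j v M r j ≡ v r
  replaceColumn-same j v M r with j ≟ j
  ... | yes _   = refl
  ... | no j≢j = ⊥-elim (j≢j refl)

  replaceColumn-other : ∀ j v M r c → c ≢ j → replaceColumn j v M r c ≡ M r c
  replaceColumn-other j v M r c c≢j with c ≟ j
  ... | yes c≡j = ⊥-elim (c≢j c≡j)
  ... | no _    = refl

  detN-addColumnMultiple : ∀ k j i M M' t → j < k →
    EqualOutsideColumn k j M' M → (∀ r → r < k → M' r j ≡ M r j + t * M r i) →
    detN k (replaceColumn j (λ r → M r i) M) ≡ + 0 →
    detN k M' ≡ detN k M
  detN-addColumnMultiple k j i M M' t j<k M'≈M M'ⱼ degenerate = begin
    detN k M'                                                     ≡⟨ detN-linear k j M' M Mᵢ (+ 1) t j<k M'≈M M'≈Mᵢ M'ⱼ' ⟩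
    + 1 * detN k M + t * detN k Mᵢ                                ≡⟨ cong (λ d → + 1 * detN k M + t * d) degenerate ⟩
    + 1 * detN k M + t * + 0                                      ≡⟨ simplify (detN k M) t ⟩
    detN k M                                                      ∎
    where
    open ≡-Reasoning
    Mᵢ : MatrixN
    Mᵢ = replaceColumn j (λ r → M r i) M
    M'≈Mᵢ : EqualOutsideColumn k j M' Mᵢ
    M'≈Mᵢ r c r< c< c≢j = trans (M'≈M r c r< c< c≢j) (sym (replaceColumn-other j _ M r c c≢j))
    M'ⱼ' : ∀ r → r < k → M' r j ≡ + 1 * M r j + t * Mᵢ r j
    M'ⱼ' r r< = trans (M'ⱼ r r<)
      (cong₂ (λ a b → a + t * b) (sym (ℤₚ.*-identityˡ (M r j))) (sym (replaceColumn-same j _ M r)))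
    simplify : ∀ d t → + 1 * d + t * + 0 ≡ d
    simplify = solve-∀

  detN-addToColumn0 : ∀ k d M M' → suc d < k →
    EqualOutsideColumn k 0 M' M → (∀ r → r < k → M' r 0 ≡ M r 0 + M r (suc d)) →
    detN k M' ≡ detN k M
  detN-addToColumn0 k d M M' d+1<k M'≈M M'₀ =
    detN-addColumnMultiple k 0 (suc d) M M' (+ 1) (ℕₚ.<-trans (s≤s z≤n) d+1<k) M'≈M
      (λ r r< → trans (M'₀ r r<) (cong (_+_ (M r 0)) (sym (ℤₚ.*-identityˡ _))))
      (detN-equalColumns d k _ d+1<k λ r _ →
        trans (replaceColumn-same 0 column M r) (sym (replaceColumn-other 0 column M r (suc d) λ ())))
    where
    column : ℕ → ℤ
    column r = M r (suc d)

  detN-addColumn0To : ∀ k d M M' t → suc d < k →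
    EqualOutsideColumn k (suc d) M' M → (∀ r → r < k → M' r (suc d) ≡ M r (suc d) + t * M r 0) →
    detN k M' ≡ detN k M
  detN-addColumn0To k d M M' t d+1<k M'≈M M'ₛ =
    detN-addColumnMultiple k (suc d) 0 M M' t d+1<k M'≈M M'ₛ
      (detN-equalColumns d k _ d+1<k λ r _ →
        trans (replaceColumn-other (suc d) column M r 0 λ ()) (sym (replaceColumn-same (suc d) column M r)))
    where
    column : ℕ → ℤ
    column r = M r 0

  detN-scaleColumn : ∀ k j s M M' → j < k → EqualOutsideColumn k j M M' →
    (∀ r → r < k → M r j ≡ s * M' r j) → detN k M ≡ s * detN k M'
  detN-scaleColumn k j s M M' j<k M≈M' Mⱼ =
    trans (detN-linear k j M M' M' s (+ 0) j<k M≈M' M≈M' λ r r< → trans (Mⱼ r r<) (sym (ℤₚ.+-identityʳ _)))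
          (ℤₚ.+-identityʳ _)

  detN-firstRowUnit : ∀ K M → (∀ c → c < K → M 0 (suc c) ≡ + 0) →
    detN (suc K) M ≡ M 0 0 * detN K (minorN 0 M)
  detN-firstRowUnit K M row₀ =
    trans (cong (_+_ (laplaceTerm K M 0)) (trans (sumN-cong K vanish) (sumN-zero K)))
          (trans (ℤₚ.+-identityʳ _) (ℤₚ.*-identityˡ _))
    where
    vanish : ∀ j → j < K → laplaceTerm K M (suc j) ≡ + 0
    vanish j j< rewrite row₀ j j< = ℤₚ.*-zeroʳ (sign (suc j))
    sumN-zero : ∀ K → sumN K (λ _ → + 0) ≡ + 0
    sumN-zero zero    = refl
    sumN-zero (suc K) = trans (ℤₚ.+-identityˡ _) (sumN-zero K)

  addColumnsToColumn0 : ℕ → MatrixN → MatrixN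
  addColumnsToColumn0 t M r zero    = sumN (suc t) (M r)
  addColumnsToColumn0 t M r (suc c) = M r (suc c)

  sumN-snoc : ∀ k f → sumN (suc k) f ≡ sumN k f + f k
  sumN-snoc zero    f = trans (ℤₚ.+-identityʳ (f 0)) (sym (ℤₚ.+-identityˡ (f 0)))
  sumN-snoc (suc k) f = trans (cong (_+_ (f 0)) (sumN-snoc k (f ∘ suc))) (sym (ℤₚ.+-assoc (f 0) _ _))

  detN-addColumnsToColumn0 : ∀ k t M → t < k → detN k (addColumnsToColumn0 t M) ≡ detN k M
  detN-addColumnsToColumn0 k zero    M _ = detN-cong k λ where
    r zero    _ _ → ℤₚ.+-identityʳ (M r 0)
    r (suc c) _ _ → refl
  detN-addColumnsToColumn0 k (suc t) M t+1<k =
    trans (detN-addToColumn0 k t (addColumnsToColumn0 t M) (addColumnsToColumn0 (suc t) M) t+1<k unchanged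
            (λ r _ → sumN-snoc (suc t) (M r)))
          (detN-addColumnsToColumn0 k t M (ℕₚ.<-trans (ℕₚ.n<1+n t) t+1<k))
    where
    unchanged : EqualOutsideColumn k 0 (addColumnsToColumn0 (suc t) M) (addColumnsToColumn0 t M)
    unchanged r zero    _ _ 0≢0 = ⊥-elim (0≢0 refl)
    unchanged r (suc c) _ _ _   = refl

  addColumn0ToColumns : ℕ → ℤ → MatrixN → MatrixN
  addColumn0ToColumns t s M r zero = M r zero
  addColumn0ToColumns t s M r (suc c) with c <? t
  ... | yes _ = M r (suc c) + s * M r 0
  ... | no  _ = M r (suc c)

  detN-addColumn0ToColumns : ∀ k t s M → t < k → detN k (addColumn0ToColumns t s M) ≡ detN k M
  detN-addColumn0ToColumns k zero    s M _ = detN-cong k untouched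
    where
    untouched : ∀ r c → r < k → c < k → addColumn0ToColumns 0 s M r c ≡ M r c
    untouched r zero    _ _ = refl
    untouched r (suc c) _ _ with c <? 0
    ... | no _ = refl
  detN-addColumn0ToColumns k (suc t) s M t+1<k =
    trans (detN-addColumn0To k t (addColumn0ToColumns t s M) (addColumn0ToColumns (suc t) s M) s t+1<k unchanged added)
          (detN-addColumn0ToColumns k t s M (ℕₚ.<-trans (ℕₚ.n<1+n t) t+1<k))
    where
    unchanged : EqualOutsideColumn k (suc t) (addColumn0ToColumns (suc t) s M) (addColumn0ToColumns t s M)
    unchanged r zero    _ _ _ = refl
    unchanged r (suc c) _ _ c≢t with c <? suc t | c <? t
    ... | yes _   | yes _   = refl
    ... | no _    | no _    = refl
    ... | yes c<t+1 | no c≮t = ⊥-elim (c≢t (cong suc (ℕₚ.≤-antisym (ℕₚ.≤-pred c<t+1) (ℕₚ.≮⇒≥ c≮t))))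
    ... | no c≮t+1  | yes c<t = ⊥-elim (c≮t+1 (ℕₚ.m<n⇒m<1+n c<t))
    added : ∀ r → r < k → addColumn0ToColumns (suc t) s M r (suc t) ≡ addColumn0ToColumns t s M r (suc t) + s * M r 0
    added r _ with t <? suc t | t <? t
    ... | _       | yes t<t = ⊥-elim (ℕₚ.n≮n t t<t)
    ... | no t≮t+1 | _      = ⊥-elim (t≮t+1 (ℕₚ.n<1+n t))
    ... | yes _   | no _    = refl

  diagOff : ℤ → ℤ → MatrixN
  diagOff a b zero    zero    = a
  diagOff a b zero    (suc c) = b
  diagOff a b (suc r) zero    = b
  diagOff a b (suc r) (suc c) = diagOff a b r c

  diagOff-shift : ∀ a b t r c → diagOff a b r c + t ≡ diagOff (a + t) (b + t) r c
  diagOff-shift a b t zero    zero    = refl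
  diagOff-shift a b t zero    (suc c) = refl
  diagOff-shift a b t (suc r) zero    = refl
  diagOff-shift a b t (suc r) (suc c) = diagOff-shift a b t r c

  detN-scalar : ∀ a K → detN K (diagOff a (+ 0)) ≡ a ^ K
  detN-scalar a zero    = refl
  detN-scalar a (suc K) = trans (detN-firstRowUnit K (diagOff a (+ 0)) (λ _ _ → refl)) (cong (a *_) (detN-scalar a K))

  sumN-const : ∀ K b → sumN K (λ _ → b) ≡ + K * b
  sumN-const zero    b = sym (ℤₚ.*-zeroˡ b)
  sumN-const (suc K) b = trans (cong (_+_ b) (sumN-const K b)) (add-one (+ K) b)
    where
    add-one : ∀ k b → b + k * b ≡ (+ 1 + k) * b
    add-one = solve-∀

  sumN-diagOff-row : ∀ a b K r → r ≤ K → sumN (suc K) (diagOff a b r) ≡ a + + K * b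
  sumN-diagOff-row a b K       zero    _         = cong (_+_ a) (sumN-const K b)
  sumN-diagOff-row a b (suc K) (suc r) (s≤s r≤K) =
    trans (cong (_+_ b) (sumN-diagOff-row a b K r r≤K)) (add-one a b (+ K))
    where
    add-one : ∀ a b k → b + (a + k * b) ≡ a + (+ 1 + k) * b
    add-one = solve-∀

  -- Adding all columns to column 0 makes it constant, equal to the row sum
  -- a + K b; after factoring that out, subtracting b times column 0 from the
  -- other columns clears the first row and leaves (a - b) I below it.
  detN-diagOff : ∀ a b K → detN (suc K) (diagOff a b) ≡ (a + + K * b) * (a - b) ^ K
  detN-diagOff a b K = begin
    detN (suc K) (diagOff a b)                       ≡⟨ sym (detN-addColumnsToColumn0 (suc K) K (diagOff a b) (ℕₚ.n<1+n K)) ⟩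
    detN (suc K) (addColumnsToColumn0 K (diagOff a b)) ≡⟨ detN-scaleColumn (suc K) 0 rowSum _ U (s≤s z≤n) sameOutside scaled ⟩
    rowSum * detN (suc K) U                          ≡⟨ cong (rowSum *_) (sym (detN-addColumn0ToColumns (suc K) K (- b) U (ℕₚ.n<1+n K))) ⟩
    rowSum * detN (suc K) (addColumn0ToColumns K (- b) U) ≡⟨ cong (rowSum *_) (detN-firstRowUnit K (addColumn0ToColumns K (- b) U) firstRow) ⟩
    rowSum * (+ 1 * detN K (minorN 0 (addColumn0ToColumns K (- b) U))) ≡⟨ cong (rowSum *_) (ℤₚ.*-identityˡ _) ⟩
    rowSum * detN K (minorN 0 (addColumn0ToColumns K (- b) U)) ≡⟨ cong (rowSum *_) (detN-cong K lowerBlock) ⟩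
    rowSum * detN K (diagOff (a - b) (+ 0))          ≡⟨ cong (rowSum *_) (detN-scalar (a - b) K) ⟩
    rowSum * (a - b) ^ K                             ∎
    where
    open ≡-Reasoning
    rowSum : ℤ
    rowSum = a + + K * b
    U : MatrixN
    U = replaceColumn 0 (λ _ → + 1) (diagOff a b)
    sameOutside : EqualOutsideColumn (suc K) 0 (addColumnsToColumn0 K (diagOff a b)) U
    sameOutside r zero    _ _ 0≢0 = ⊥-elim (0≢0 refl)
    sameOutside r (suc c) _ _ _   = refl
    scaled : ∀ r → r < suc K → addColumnsToColumn0 K (diagOff a b) r 0 ≡ rowSum * U r 0
    scaled r r< = trans (sumN-diagOff-row a b K r (ℕₚ.≤-pred r<)) (sym (ℤₚ.*-identityʳ rowSum))
    firstRow : ∀ c → c < K → addColumn0ToColumns K (- b) U 0 (suc c) ≡ + 0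
    firstRow c c<K with c <? K
    ... | yes _   = trans (cong (_+_ b) (ℤₚ.*-identityʳ (- b))) (ℤₚ.+-inverseʳ b)
    ... | no c≮K = ⊥-elim (c≮K c<K)
    lowerBlock : ∀ r c → r < K → c < K → addColumn0ToColumns K (- b) U (suc r) (suc c) ≡ diagOff (a - b) (+ 0) r c
    lowerBlock r c _ c<K with c <? K
    ... | yes _   = trans (cong (_+_ (diagOff a b r c)) (ℤₚ.*-identityʳ (- b)))
                      (trans (diagOff-shift a b (- b) r c) (cong (λ z → diagOff (a - b) z r c) (ℤₚ.+-inverseʳ b)))
    ... | no c≮K = ⊥-elim (c≮K c<K)

  diagOff-diagonal : ∀ a b r → diagOff a b r r ≡ a
  diagOff-diagonal a b zero    = refl
  diagOff-diagonal a b (suc r) = diagOff-diagonal a b r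

  diagOff-offDiagonal : ∀ a b r c → r ≢ c → diagOff a b r c ≡ b
  diagOff-offDiagonal a b zero    zero    r≢c = ⊥-elim (r≢c refl)
  diagOff-offDiagonal a b zero    (suc c) _   = refl
  diagOff-offDiagonal a b (suc r) zero    _   = refl
  diagOff-offDiagonal a b (suc r) (suc c) r≢c = diagOff-offDiagonal a b r c (r≢c ∘ cong suc)

  det-charMat-complete : ∀ {k} K → k ≡ suc K → (A : Matrix k) → (∀ i → A i i ≡ + 0) →
    (∀ i j → i ≢ j → A i j ≡ + 1) → ∀ x → det k (charMat x A) ≡ (x - + K) * (x + + 1) ^ K
  det-charMat-complete K refl A loopless complete x =
    trans (det≡detN (suc K) (charMat x A) (diagOff x -1ℤ) entries)
      (trans (detN-diagOff x -1ℤ K) (cong (_* (x + + 1) ^ K) (minus-K x (+ K))))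
    where
    entries : ∀ i j → charMat x A i j ≡ diagOff x -1ℤ (toℕ i) (toℕ j)
    entries i j with i Fin.≟ j
    ... | yes refl = trans (cong (_-_ x) (loopless i))
                       (trans (ℤₚ.+-identityʳ x) (sym (diagOff-diagonal x -1ℤ (toℕ i))))
    ... | no i≢j   = trans (cong -_ (complete i j i≢j))
                       (sym (diagOff-offDiagonal x -1ℤ (toℕ i) (toℕ j) (i≢j ∘ FinP.toℕ-injective)))
    minus-K : ∀ x k → x + k * -1ℤ ≡ x - k
    minus-K = solve-∀

module PrimePowers where

  open import Data.Nat using (ℕ; zero; suc; _<_; _≤_; z≤n; s≤s; _*_; _∸_; _^_)
  import Data.Nat as ℕ
  import Data.Nat.Properties as ℕₚ
  open import Data.Nat.Divisibility
  open import Data.Nat.Primality using (Prime; prime⇒irreducible; prime⇒nonZero)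
  open import Data.Nat.Coprimality using (Coprime; coprime-divisor)
  open import Data.Product using (∃-syntax; _×_; _,_)
  open import Data.Sum using (_⊎_; inj₁; inj₂; [_,_]′)
  open import Data.Empty using (⊥-elim)
  open import Relation.Nullary using (¬_; yes; no; Dec)
  open import Relation.Binary.PropositionalEquality

  prime∤⇒coprime : ∀ {p d} → Prime p → ¬ (p ∣ d) → Coprime d p
  prime∤⇒coprime pr p∤d (i∣d , i∣p) with prime⇒irreducible pr i∣p
  ... | inj₁ i≡1  = i≡1
  ... | inj₂ refl = ⊥-elim (p∤d i∣d)

  ∣p^m⇒≡p^k : ∀ {p} → Prime p → ∀ m d → d ∣ p ^ m → ∃[ k ] (k ≤ m × d ≡ p ^ k)
  ∣p^m⇒≡p^k pr zero d d∣1 = 0 , z≤n , ∣1⇒≡1 d∣1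
  ∣p^m⇒≡p^k {p} pr (suc m) d d∣p^[1+m] with p ∣? d
  ... | no p∤d =
    let k , k≤m , d≡p^k = ∣p^m⇒≡p^k pr m d (coprime-divisor (prime∤⇒coprime pr p∤d) d∣p^[1+m])
    in k , ℕₚ.m≤n⇒m≤1+n k≤m , d≡p^k
  ... | yes (divides e refl) =
    let e∣p^m = *-cancelˡ-∣ p {{prime⇒nonZero pr}} (subst (_∣ p * p ^ m) (ℕₚ.*-comm e p) d∣p^[1+m])
        k , k≤m , e≡p^k = ∣p^m⇒≡p^k pr m e e∣p^m
    in suc k , s≤s k≤m , trans (cong (_* p) e≡p^k) (ℕₚ.*-comm (p ^ k) p)

  ^-monoʳ-∣ : ∀ p {a b} → a ≤ b → p ^ a ∣ p ^ b
  ^-monoʳ-∣ p {a} {b} a≤b = divides (p ^ (b ∸ a)) (begin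
    p ^ b                ≡⟨ cong (p ^_) (sym (ℕₚ.m+[n∸m]≡n a≤b)) ⟩
    p ^ (a ℕ.+ (b ∸ a))  ≡⟨ ℕₚ.^-distribˡ-+-* p a (b ∸ a) ⟩
    p ^ a * p ^ (b ∸ a)  ≡⟨ ℕₚ.*-comm (p ^ a) _ ⟩
    p ^ (b ∸ a) * p ^ a  ∎)
    where open ≡-Reasoning

  p^b∤p^a : ∀ p → 1 < p → ∀ {a b} → a < b → ¬ (p ^ b ∣ p ^ a)
  p^b∤p^a p 1<p {a} a<b p^b∣p^a =
    ℕₚ.<⇒≱ (ℕₚ.^-monoʳ-< p 1<p a<b) (∣⇒≤ {{ℕₚ.m^n≢0 p a {{ℕ.>-nonZero (ℕₚ.<-trans (s≤s z≤n) 1<p)}}}} p^b∣p^a)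

  least : (P : ℕ → Set) → (∀ h → Dec (P h)) → ∀ a → P a → ∃[ g ] (P g × (∀ h → h < g → ¬ P h))
  least P P? a Pa with search (suc a)
    where
    search : ∀ N → (∃[ g ] (P g × (∀ h → h < g → ¬ P h))) ⊎ (∀ h → h < N → ¬ P h)
    search zero = inj₂ (λ _ ())
    search (suc N) with search N
    ... | inj₁ found = inj₁ found
    ... | inj₂ none with P? N
    ...   | yes PN  = inj₁ (N , PN , none)
    ...   | no ¬PN = inj₂ λ h h<1+N → [ none h , (λ { refl → ¬PN }) ]′ (ℕₚ.m≤n⇒m<n∨m≡n (ℕₚ.≤-pred h<1+N))
  ... | inj₁ found = found
  ... | inj₂ none  = ⊥-elim (none a (ℕₚ.n<1+n a) Pa)

module PrimePowerIdeals (p m : ℕ) (pr : Prime p) where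

  open import Data.Nat using (ℕ; zero; suc; pred; _<_; _≤_; z≤n; s≤s; _*_; _+_; _∸_; _^_; NonZero; _%_; _/_)
  import Data.Nat as ℕ
  import Data.Nat.Properties as ℕₚ
  open import Data.Nat.Divisibility
  open import Data.Nat.DivMod
  open import Data.Nat.Primality using (prime⇒nonTrivial; prime⇒nonZero)
  open import Data.Fin using (Fin; toℕ; fromℕ<)
  open import Data.Fin.Properties using (toℕ-fromℕ<; fromℕ<-cong; fromℕ<-toℕ; toℕ<n; toℕ-injective; injective⇒≤)
  open import Data.Fin.Subset using (Subset; _∈_; _∉_; inside; outside)
  open import Data.Fin.Subset.Properties using (_∈?_; ⊆-antisym)
  open import Data.Vec using (tabulate)
  open import Data.Vec.Properties using (lookup⇒[]=; []=⇒lookup; lookup∘tabulate)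
  open import Data.Product using (∃-syntax; _×_; _,_; proj₁; proj₂)
  open import Data.Empty using (⊥-elim)
  open import Relation.Nullary using (¬_; yes; no)
  open import Relation.Nullary.Decidable using (_×-dec_)
  open import Relation.Binary.PropositionalEquality
  open import Relation.Binary.Definitions using (tri<; tri≈; tri>)
  open import Data.List using (length; lookup)
  import Data.List.Membership.Propositional as LM
  open import Data.List.Membership.Propositional.Properties using (∈-lookup)
  import Data.List.Relation.Unary.Any as Any
  open import Data.List.Relation.Unary.Any.Properties using (lookup-index)
  open import Function.Bundles using (Equivalence)
  open import Defs using (module Zn; primePowNonZero)
  open PrimePowers

  n : ℕ
  n = p ^ m

  instance
    n≢0 : NonZero n
    n≢0 = primePowNonZero pr m
    p≢0 : NonZero p
    p≢0 = prime⇒nonZero pr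

  open Zn n

  1<p : 1 < p
  1<p = ℕ.nonTrivial⇒n>1 p {{prime⇒nonTrivial pr}}

  toℕ-toZn : ∀ a → toℕ (toZn a) ≡ a % n
  toℕ-toZn a = toℕ-fromℕ< (m%n<n a n)

  toZn-cong : ∀ a b → a % n ≡ b % n → toZn a ≡ toZn b
  toZn-cong a b a≡b = fromℕ<-cong _ _ a≡b _ _

  toZn-toℕ : ∀ x → toZn (toℕ x) ≡ x
  toZn-toℕ x = trans (fromℕ<-cong _ _ (m<n⇒m%n≡m (toℕ<n x)) _ (toℕ<n x)) (fromℕ<-toℕ x _)

  toℕ-toZn-< : ∀ a → a < n → toℕ (toZn a) ≡ a
  toℕ-toZn-< a a<n = trans (toℕ-toZn a) (m<n⇒m%n≡m a<n)

  toℕ-0ₙ : toℕ 0ₙ ≡ 0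
  toℕ-0ₙ = trans (toℕ-toZn 0) (m*n%n≡0 0 n)

  toZn-n : toZn n ≡ 0ₙ
  toZn-n = toZn-cong n 0 (trans (n%n≡0 n) (sym (m*n%n≡0 0 n)))

  module _ {S : Subset n} (ideal : IsIdeal S) where
    open IsIdeal ideal

    *-closedℕ : ∀ w a → toZn a ∈ S → toZn (w * a) ∈ S
    *-closedℕ w a a∈S = subst (_∈ S) (toZn-cong _ _ (begin
      (toℕ (toZn w) * toℕ (toZn a)) % n  ≡⟨ cong₂ (λ u v → (u * v) % n) (toℕ-toZn w) (toℕ-toZn a) ⟩
      (w % n * (a % n)) % n              ≡⟨ sym (%-distribˡ-* w a n) ⟩
      (w * a) % n                        ∎))
      (mul-closed (toZn w) (toZn a) a∈S)
      where open ≡-Reasoning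

    +-closedℕ : ∀ a b → toZn a ∈ S → toZn b ∈ S → toZn (a + b) ∈ S
    +-closedℕ a b a∈S b∈S = subst (_∈ S) (toZn-cong _ _ (trans (cong₂ (λ u v → (u + v) % n) (toℕ-toZn a) (toℕ-toZn b))
                                                            (sym (%-distribˡ-+ a b n))))
      (+-closed (toZn a) (toZn b) a∈S b∈S)

    -- a ∸ b is a + (n - 1) b modulo n
    ∸-closedℕ : ∀ a b → b ≤ a → toZn a ∈ S → toZn b ∈ S → toZn (a ∸ b) ∈ S
    ∸-closedℕ a b b≤a a∈S b∈S =
      subst (_∈ S) (toZn-cong _ _ (trans (cong (_% n) rearrange) (%-remove-+ʳ (a ∸ b) (m∣m*n b))))
        (+-closedℕ a (pred n * b) a∈S (*-closedℕ (pred n) b b∈S))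
      where
      rearrange : a + pred n * b ≡ (a ∸ b) + n * b
      rearrange = begin
        a + pred n * b                ≡⟨ cong (_+ pred n * b) (sym (ℕₚ.m∸n+n≡m b≤a)) ⟩
        (a ∸ b) + b + pred n * b      ≡⟨ ℕₚ.+-assoc (a ∸ b) b _ ⟩
        (a ∸ b) + suc (pred n) * b    ≡⟨ cong (λ z → (a ∸ b) + z * b) (ℕₚ.suc-pred n) ⟩
        (a ∸ b) + n * b               ∎
        where open ≡-Reasoning

    n∈ : toZn n ∈ S
    n∈ = subst (_∈ S) (sym toZn-n) zero∈

  side : ℕ → Fin n → Data.Fin.Subset.Side
  side k y with p ^ k ∣? toℕ y
  ... | yes _ = inside
  ... | no  _ = outside

  powerIdeal : ℕ → Subset n
  powerIdeal k = tabulate (side k)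

  ∈-powerIdeal⁺ : ∀ k y → p ^ k ∣ toℕ y → y ∈ powerIdeal k
  ∈-powerIdeal⁺ k y p^k∣y = lookup⇒[]= y (powerIdeal k) (trans (lookup∘tabulate (side k) y) inside≡)
    where
    inside≡ : side k y ≡ inside
    inside≡ with p ^ k ∣? toℕ y
    ... | yes _      = refl
    ... | no p^k∤y = ⊥-elim (p^k∤y p^k∣y)

  ∈-powerIdeal⁻ : ∀ k y → y ∈ powerIdeal k → p ^ k ∣ toℕ y
  ∈-powerIdeal⁻ k y y∈ = divides-if-inside (trans (sym (lookup∘tabulate (side k) y)) ([]=⇒lookup y∈))
    where
    divides-if-inside : side k y ≡ inside → p ^ k ∣ toℕ y
    divides-if-inside inside≡ with p ^ k ∣? toℕ y
    divides-if-inside refl | yes p^k∣y = p^k∣y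

  PositiveIn : Subset n → ℕ → Set
  PositiveIn S h = 0 < h × toZn h ∈ S

  leastPositive-∣ : ∀ {S} → IsIdeal S → ∀ g .{{_ : NonZero g}} → toZn g ∈ S →
    (∀ h → h < g → ¬ PositiveIn S h) → ∀ t → toZn t ∈ S → g ∣ t
  leastPositive-∣ {S} ideal g g∈S minimal t t∈S with t % g ℕ.≟ 0
  ... | yes t%g≡0 = m%n≡0⇒n∣m t g t%g≡0
  ... | no  t%g≢0 = ⊥-elim (minimal (t % g) (m%n<n t g) (ℕₚ.n≢0⇒n>0 t%g≢0 , remainder∈S))
    where
    remainder∈S : toZn (t % g) ∈ S
    remainder∈S = subst (λ r → toZn r ∈ S) (sym (m%n≡m∸m/n*n t g))
      (∸-closedℕ ideal t (t / g * g) (m/n*n≤m t g) t∈S (*-closedℕ ideal (t / g) g g∈S))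

  nonzeroIdeal≡powerIdeal : ∀ {S} → IsIdeal S → NonzeroSet S → ∃[ k ] (k < m × S ≡ powerIdeal k)
  nonzeroIdeal≡powerIdeal {S} ideal (x , x∈S , x≢0) = k , k<m , ⊆-antisym S⊆powerIdeal powerIdeal⊆S
    where
    x∈S' : toZn (toℕ x) ∈ S
    x∈S' = subst (_∈ S) (sym (toZn-toℕ x)) x∈S
    0<x : 0 < toℕ x
    0<x = ℕₚ.n≢0⇒n>0 λ x≡0 → x≢0 (toℕ-injective (trans x≡0 (sym toℕ-0ₙ)))
    minimum : ∃[ g ] (PositiveIn S g × (∀ h → h < g → ¬ PositiveIn S h))
    minimum = least (PositiveIn S) (λ h → (0 ℕₚ.<? h) ×-dec (toZn h ∈? S)) (toℕ x) (0<x , x∈S')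
    g : ℕ
    g = proj₁ minimum
    instance
      g≢0 : NonZero g
      g≢0 = ℕ.>-nonZero (proj₁ (proj₁ (proj₂ minimum)))
    g∈S : toZn g ∈ S
    g∈S = proj₂ (proj₁ (proj₂ minimum))
    g≤x : g ≤ toℕ x
    g≤x = ℕₚ.≮⇒≥ λ x<g → proj₂ (proj₂ minimum) (toℕ x) x<g (0<x , x∈S')
    g∣ : ∀ t → toZn t ∈ S → g ∣ t
    g∣ = leastPositive-∣ ideal g g∈S (proj₂ (proj₂ minimum))
    power : ∃[ k ] (k ≤ m × g ≡ p ^ k)
    power = ∣p^m⇒≡p^k pr m g (g∣ n (n∈ ideal))
    k : ℕ
    k = proj₁ power
    g≡p^k : g ≡ p ^ k
    g≡p^k = proj₂ (proj₂ power)
    k<m : k < m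
    k<m = ℕₚ.≤∧≢⇒< (proj₁ (proj₂ power)) λ k≡m →
      ℕₚ.<-irrefl (trans g≡p^k (cong (p ^_) k≡m)) (ℕₚ.≤-<-trans g≤x (toℕ<n x))
    S⊆powerIdeal : ∀ {y} → y ∈ S → y ∈ powerIdeal k
    S⊆powerIdeal {y} y∈S = ∈-powerIdeal⁺ k y
      (subst (_∣ toℕ y) g≡p^k (g∣ (toℕ y) (subst (_∈ S) (sym (toZn-toℕ y)) y∈S)))
    powerIdeal⊆S : ∀ {y} → y ∈ powerIdeal k → y ∈ S
    powerIdeal⊆S {y} y∈ with ∈-powerIdeal⁻ k y y∈
    ... | divides w y≡w*p^k = subst (_∈ S)
      (trans (cong toZn (trans (cong (w *_) g≡p^k) (sym y≡w*p^k))) (toZn-toℕ y))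
      (*-closedℕ ideal w g g∈S)

  powerIdeal-isIdeal : ∀ k → k ≤ m → IsIdeal (powerIdeal k)
  powerIdeal-isIdeal k k≤m = record
    { zero∈      = ∈-powerIdeal⁺ k 0ₙ (subst (p ^ k ∣_) (sym toℕ-0ₙ) (_∣0 (p ^ k)))
    ; +-closed   = λ a b a∈ b∈ → ∈-powerIdeal⁺ k _ (reduce (∣m∣n⇒∣m+n (∈-powerIdeal⁻ k a a∈) (∈-powerIdeal⁻ k b b∈)))
    ; neg-closed = λ a a∈ → ∈-powerIdeal⁺ k _ (reduce (∣m+n∣m⇒∣n
        (subst (p ^ k ∣_) (sym (ℕₚ.m+[n∸m]≡n (ℕₚ.<⇒≤ (toℕ<n a)))) p^k∣n) (∈-powerIdeal⁻ k a a∈)))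
    ; mul-closed = λ r a a∈ → ∈-powerIdeal⁺ k _ (reduce (∣n⇒∣m*n (toℕ r) (∈-powerIdeal⁻ k a a∈)))
    }
    where
    p^k∣n : p ^ k ∣ n
    p^k∣n = ^-monoʳ-∣ p k≤m
    reduce : ∀ {a} → p ^ k ∣ a → p ^ k ∣ toℕ (toZn a)
    reduce p^k∣a = subst (p ^ k ∣_) (sym (toℕ-toZn _)) (%-presˡ-∣ p^k∣a p^k∣n)

  toℕ-p^k : ∀ k → k < m → toℕ (toZn (p ^ k)) ≡ p ^ k
  toℕ-p^k k k<m = toℕ-toZn-< _ (ℕₚ.^-monoʳ-< p 1<p k<m)

  p^k∈powerIdeal : ∀ k → k < m → toZn (p ^ k) ∈ powerIdeal k
  p^k∈powerIdeal k k<m = ∈-powerIdeal⁺ k _ (subst (p ^ k ∣_) (sym (toℕ-p^k k k<m)) ∣-refl)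

  p^k≢0ₙ : ∀ k → k < m → toZn (p ^ k) ≢ 0ₙ
  p^k≢0ₙ k k<m p^k≡0 = ℕ.≢-nonZero⁻¹ (p ^ k) {{ℕₚ.m^n≢0 p k}} (trans (sym (toℕ-p^k k k<m)) (trans (cong toℕ p^k≡0) toℕ-0ₙ))

  powerIdeal-nonzeroProper : ∀ k → 1 ≤ k → k < m → IsNonzeroProperIdeal (powerIdeal k)
  powerIdeal-nonzeroProper k 1≤k k<m =
    powerIdeal-isIdeal k (ℕₚ.<⇒≤ k<m) , (toZn (p ^ k) , p^k∈powerIdeal k k<m , p^k≢0ₙ k k<m) , (toZn 1 , 1∉)
    where
    toℕ-1 : toℕ (toZn 1) ≡ p ^ 0
    toℕ-1 = toℕ-toZn-< (p ^ 0) (ℕₚ.^-monoʳ-< p 1<p (ℕₚ.<-trans 1≤k k<m))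
    1∉ : toZn 1 ∉ powerIdeal k
    1∉ 1∈ = p^b∤p^a p 1<p 1≤k (subst (p ^ k ∣_) toℕ-1 (∈-powerIdeal⁻ k _ 1∈))

  powerIdeal-injective : ∀ k k' → k < m → k' < m → powerIdeal k ≡ powerIdeal k' → k ≡ k'
  powerIdeal-injective k k' k<m k'<m eq with ℕₚ.<-cmp k k'
  ... | tri≈ _ k≡k' _ = k≡k'
  ... | tri< k<k' _ _ = ⊥-elim (p^b∤p^a p 1<p k<k'
        (subst (p ^ k' ∣_) (toℕ-p^k k k<m) (∈-powerIdeal⁻ k' _ (subst (toZn (p ^ k) ∈_) eq (p^k∈powerIdeal k k<m)))))
  ... | tri> _ _ k'<k = ⊥-elim (p^b∤p^a p 1<p k'<k
        (subst (p ^ k ∣_) (toℕ-p^k k' k'<m) (∈-powerIdeal⁻ k _ (subst (toZn (p ^ k') ∈_) (sym eq) (p^k∈powerIdeal k' k'<m)))))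

  nonzeroProperIdeal≡powerIdeal : ∀ {S} → IsNonzeroProperIdeal S → ∃[ k ] (1 ≤ k × k < m × S ≡ powerIdeal k)
  nonzeroProperIdeal≡powerIdeal {S} (ideal , nonzero , (z , z∉S)) = positive (nonzeroIdeal≡powerIdeal ideal nonzero)
    where
    positive : ∃[ k ] (k < m × S ≡ powerIdeal k) → ∃[ k ] (1 ≤ k × k < m × S ≡ powerIdeal k)
    positive (zero  , _   , S≡) = ⊥-elim (z∉S (subst (z ∈_) (sym S≡) (∈-powerIdeal⁺ 0 z (1∣ toℕ z))))
    positive (suc k , k<m , S≡) = suc k , s≤s z≤n , k<m , S≡

  pred[m]<m : 0 < m → pred m < m
  pred[m]<m 0<m = subst (pred m <_) (ℕₚ.suc-pred m {{ℕ.>-nonZero 0<m}}) (ℕₚ.n<1+n (pred m))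

  p^[m∸1]∈nonzeroIdeal : 0 < m → ∀ {S} → IsIdeal S → NonzeroSet S → toZn (p ^ pred m) ∈ S
  p^[m∸1]∈nonzeroIdeal 0<m {S} ideal nonzero = contains (nonzeroIdeal≡powerIdeal ideal nonzero)
    where
    contains : ∃[ k ] (k < m × S ≡ powerIdeal k) → toZn (p ^ pred m) ∈ S
    contains (k , k<m , S≡) = subst (toZn (p ^ pred m) ∈_) (sym S≡) (∈-powerIdeal⁺ k _
      (subst (p ^ k ∣_) (sym (toℕ-p^k (pred m) (pred[m]<m 0<m))) (^-monoʳ-∣ p (ℕₚ.<⇒≤pred k<m))))

  sumEssential : 0 < m → ∀ {I K} → IsIdeal I → NonzeroSet I → IsIdeal K → SumEssential I K
  sumEssential 0<m {I} {K} idealI nonzeroI idealK J idealJ nonzeroJ =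
    s , s≢0 , (s , 0ₙ , p^[m∸1]∈nonzeroIdeal 0<m idealI nonzeroI , IsIdeal.zero∈ idealK , s+0≡s) ,
    p^[m∸1]∈nonzeroIdeal 0<m idealJ nonzeroJ
    where
    s : Fin n
    s = toZn (p ^ pred m)
    s≢0 : s ≢ 0ₙ
    s≢0 = p^k≢0ₙ (pred m) (pred[m]<m 0<m)
    s+0≡s : s +ₙ 0ₙ ≡ s
    s+0≡s = trans (cong (λ z → toZn (toℕ s + z)) toℕ-0ₙ) (trans (cong toZn (ℕₚ.+-identityʳ (toℕ s))) (toZn-toℕ s))

  <pred⇒suc< : ∀ {t} → t < pred m → suc t < m
  <pred⇒suc< t<pred = ℕₚ.m≤pred[n]⇒suc[m]≤n {{ℕ.>-nonZero (ℕₚ.≤-trans (s≤s z≤n) (ℕₚ.≤pred⇒≤ t<pred))}} t<pred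

  lookup-nonzeroProper : ∀ {L} → IsVertexList L → ∀ i → IsNonzeroProperIdeal (lookup L i)
  lookup-nonzeroProper {L} (_ , vertex⇔) i = Equivalence.to (vertex⇔ (lookup L i)) (∈-lookup i)

  length-vertexList : ∀ {L} → IsVertexList L → length L ≡ pred m
  length-vertexList {L} vertices@(unique , vertex⇔) =
    ℕₚ.≤-antisym (injective⇒≤ {f = level} level-injective) (injective⇒≤ {f = position} position-injective)
    where
    exponent : ∀ i → ∃[ k ] (1 ≤ k × k < m × lookup L i ≡ powerIdeal k)
    exponent i = nonzeroProperIdeal≡powerIdeal (lookup-nonzeroProper vertices i)
    levelOf : ∀ {S} → ∃[ k ] (1 ≤ k × k < m × S ≡ powerIdeal k) → Fin (pred m)
    levelOf (k , 1≤k , k<m , _) = fromℕ< (ℕₚ.pred-mono-< {{ℕ.>-nonZero 1≤k}} k<m)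
    levelOf-injective : ∀ {S S'} (e : ∃[ k ] (1 ≤ k × k < m × S ≡ powerIdeal k))
      (e' : ∃[ k ] (1 ≤ k × k < m × S' ≡ powerIdeal k)) → levelOf e ≡ levelOf e' → S ≡ S'
    levelOf-injective (k , 1≤k , _ , S≡) (k' , 1≤k' , _ , S'≡) eq = trans S≡ (trans (cong powerIdeal k≡k') (sym S'≡))
      where
      k≡k' : k ≡ k'
      k≡k' = ℕₚ.pred-injective {{ℕ.>-nonZero 1≤k}} {{ℕ.>-nonZero 1≤k'}}
        (trans (sym (toℕ-fromℕ< _)) (trans (cong toℕ eq) (toℕ-fromℕ< _)))
    level : Fin (length L) → Fin (pred m)
    level i = levelOf (exponent i)
    level-injective : ∀ {i j} → level i ≡ level j → i ≡ j
    level-injective {i} {j} eq = lookup-injective unique i j (levelOf-injective (exponent i) (exponent j) eq)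
    membership : ∀ (t : Fin (pred m)) → powerIdeal (suc (toℕ t)) LM.∈ L
    membership t = Equivalence.from (vertex⇔ (powerIdeal (suc (toℕ t))))
      (powerIdeal-nonzeroProper (suc (toℕ t)) (s≤s z≤n) (<pred⇒suc< (toℕ<n t)))
    position : Fin (pred m) → Fin (length L)
    position t = Any.index (membership t)
    position-injective : ∀ {t u} → position t ≡ position u → t ≡ u
    position-injective {t} {u} eq = toℕ-injective (ℕₚ.suc-injective
      (powerIdeal-injective _ _ (<pred⇒suc< (toℕ<n t)) (<pred⇒suc< (toℕ<n u))
        (trans (lookup-index (membership t)) (trans (cong (lookup L) eq) (sym (lookup-index (membership u)))))))

  essentialIdealGraph-complete : 0 < m → ∀ {L} → IsVertexList L → ∀ {i j} → i ≢ j → Adjacent L i j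
  essentialIdealGraph-complete 0<m {L} vertices {i} {j} i≢j =
    i≢j , sumEssential 0<m (proj₁ vertexᵢ) (proj₁ (proj₂ vertexᵢ)) (proj₁ (lookup-nonzeroProper vertices j))
    where
    vertexᵢ : IsNonzeroProperIdeal (lookup L i)
    vertexᵢ = lookup-nonzeroProper vertices i

open import Defs
open import Data.Nat using (NonZero; suc; pred; z≤n; s≤s)
open import Data.Nat.Properties using (≤-trans)
open import Data.Integer using (ℤ; +_; _-_; _*_; _^_)
import Data.Integer as ℤ
open import Data.List using (length)
open import Data.Fin.Subset using (Subset)
open import Data.Product using (_,_)
open import Data.Sum using (inj₁; inj₂)

module _ {n : ℕ} .{{_ : NonZero n}} (L : List (Subset n)) {A : Matrix (length L)}
         (adjacency : Zn.IsAdjacencyMatrix n L A) where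

  open Zn n

  adjacencyMatrix-diagonal : ∀ i → A i i ≡ + 0
  adjacencyMatrix-diagonal i with adjacency i i
  ... | inj₁ (_ , i≢i , _) = ⊥-elim (i≢i refl)
  ... | inj₂ (Aᵢᵢ≡0 , _)   = Aᵢᵢ≡0

  adjacencyMatrix-adjacent : ∀ {i j} → Adjacent L i j → A i j ≡ + 1
  adjacencyMatrix-adjacent {i} {j} adjacent with adjacency i j
  ... | inj₁ (Aᵢⱼ≡1 , _)      = Aᵢⱼ≡1
  ... | inj₂ (_ , ¬adjacent) = ⊥-elim (¬adjacent adjacent)

pred[m]≡suc[m∸2] : ∀ {m} → 2 < m → pred m ≡ suc (m ∸ 2)
pred[m]≡suc[m∸2] {1}           (s≤s ())
pred[m]≡suc[m∸2] {suc (suc m)} _ = refl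

mainTheorem2 : (p m : ℕ) (pr : Prime p) → 2 < m →
    (L : List (Subset (p Data.Nat.^ m))) →
    Zn.IsVertexList (p Data.Nat.^ m) {{primePowNonZero pr m}} L →
    (A : Matrix (length L)) →
    Zn.IsAdjacencyMatrix (p Data.Nat.^ m) {{primePowNonZero pr m}} L A →
    ∀ (x : ℤ) → det (length L) (charMat x A)
      ≡ (x - + (m ∸ 2)) * ((x ℤ.+ + 1) ^ (m ∸ 2))
mainTheorem2 p m pr 2<m L vertices A adjacency =
  Determinant.det-charMat-complete (m ∸ 2) (trans (length-vertexList vertices) (pred[m]≡suc[m∸2] 2<m)) A
    (adjacencyMatrix-diagonal L adjacency)
    (λ i j i≢j → adjacencyMatrix-adjacent L adjacency (essentialIdealGraph-complete 0<m vertices i≢j))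
  where
  open PrimePowerIdeals p m pr
  0<m : 0 < m
  0<m = ≤-trans (s≤s z≤n) 2<m
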